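{- For every integer $n\ge 1$, $$\sum_{k=0}^{n-1}{2n\brack 2k+1}_q(-q;q)_{2n-2k-2}(-1)^kE_{2k+1}(q)=(-q;q)_{2n-1}.$$
   Context: For a nonnegative integer $m$, $(t;q)_m=\prod_{i=0}^{m-1}(1-tq^i)$ with $(t;q)_0=1$; thus $(-q;q)_m=(1+q)(1+q^2)\cdots(1+q^m)$. The $q$-binomial coefficients are ${n\brack k}_q=\frac{(q;q)_n}{(q;q)_{n-k}(q;q)_k}$ for $0\le k\le n$ and $0$ otherwise. Define $\sin_q(x)=\sum_{n\ge0}(-1)^n\frac{x^{2n+1}}{(q;q)_{2n+1}}$ and $\cos_q(x)=\sum_{n\ge0}(-1)^n\frac{x^{2n}}{(q;q)_{2n}}$; the $q$-tangent numbers $E_{2n+1}(q)$ are defined by $\frac{\sin_q(x)}{\cos_q(x)}=\sum_{n\ge0}E_{2n+1}(q)\frac{x^{2n+1}}{(q;q)_{2n+1}}$. (Equivalently, $E_{2n+1}(q)=\sum_{\pi}q^{\mathrm{inv}(\pi)}$ over permutations $\pi$ of $[2n+1]$ with $\pi_1>\pi_2<\pi_3>\pi_4<\cdots$, where $\mathrm{inv}(\pi)$ is the number of pairs $i<j$ with $\pi_i>\pi_j$.) -}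

module Defs where

open import Level using (Level)
open import Data.Nat using (ℕ; zero; suc; _≡ᵇ_)
open import Data.Bool using (if_then_else_)
open import Algebra.Bundles using (CommutativeRing)

-- All q-quantities are evaluated at an arbitrary element q of an arbitrary
-- commutative ring R; taking R = ℤ[q] and q the indeterminate recovers the
-- polynomial identity, so quantifying over all (R, q) is exactly the identity in ℤ[q].
module Q {c ℓ : Level} (R : CommutativeRing c ℓ) (q : CommutativeRing.Carrier R) where
  open CommutativeRing R

  pow : Carrier → ℕ → Carrier
  pow x zero    = 1#
  pow x (suc n) = x * pow x n

  sgn : ℕ → Carrier
  sgn zero    = 1#
  sgn (suc n) = - sgn n

  Σ< : ℕ → (ℕ → Carrier) → Carrier
  Σ< zero    f = 0#
  Σ< (suc n) f = Σ< n f + f n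

  negPoch : ℕ → Carrier
  negPoch zero    = 1#
  negPoch (suc m) = negPoch m * (1# + pow q (suc m))

  qbin : ℕ → ℕ → Carrier
  qbin zero    zero    = 1#
  qbin zero    (suc k) = 0#
  qbin (suc n) zero    = 1#
  qbin (suc n) (suc k) = qbin n k + pow q (suc k) * qbin n (suc k)

  -- Coefficient of x^(2n+1) in  tan_q(x) · cos_q(x) = sin_q(x),  multiplied by (q;q)_{2n+1}:
  --   Σ_{k=0}^{n} (-1)^(n-k) [2n+1, 2k+1]_q E_{2k+1}(q) = (-1)^n,
  -- solved for E_{2n+1}(q).  tanTable n k = E_{2k+1}(q) for k ≤ n.
  tanTable : ℕ → ℕ → Carrier
  tanTable zero    k = 1#
  tanTable (suc n) k =
    if k ≡ᵇ suc n
    then sgn (suc n) - Σ< (suc n) (λ j → sgn (suc n Data.Nat.∸ j) * qbin (suc (2 Data.Nat.* suc n)) (suc (2 Data.Nat.* j)) * tanTable n j)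
    else tanTable n k

  -- E_{2k+1}(q)
  E : ℕ → Carrier
  E k = tanTable k k

{-# OPTIONS --safe #-}
-- Read a sequence f as its q-exponential generating function Σ f N xᴺ / (q;q)_N, so that q-binomial
-- convolution ⋆ is multiplication; cosh and sinh have all even, resp. all odd, coefficients equal to 1.
-- As tan(ix) = i tanh(x), the recurrence defining E says that tanh, with odd coefficients (-1)ᵏ E_{2k+1},
-- satisfies tanh · cosh = sinh.  Let P have coefficients (-q;q)_{N-1} (and 0 at N = 0), with even and
-- odd parts Pₑ and Pₒ.  A q-difference equation for P(-x) shows that P(-x) · e_q(x), where e_q has all
-- coefficients 1, has coefficients 0, -1, 0, -1, …; its vanishing even coefficients say Pₒ · sinh = Pₑ · cosh.  Hence
-- (tanh · Pₒ) · cosh = sinh · Pₒ = Pₑ · cosh, and cosh, having constant term 1, cancels: tanh · Pₒ = Pₑ.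
-- The coefficient of x²ⁿ in this identity is the theorem.
module Submission where

open import Defs
open import Level using (Level)
open import Data.Nat using (ℕ; _≤_; _*_; _+_; _∸_)
open import Algebra.Bundles using (CommutativeRing)

open import Data.Nat.Base using (zero; suc; _<_; z≤n; s≤s; _≡ᵇ_)
import Data.Nat.Properties as ℕ
open import Data.Nat.Induction using (<-rec)
open import Data.Bool.Base using (true; false)
open import Data.Sum.Base using (inj₁; inj₂)
open import Function.Base using (_∘_; const)
import Relation.Binary.PropositionalEquality as ≡
open ≡ using (_≡_)
import Relation.Binary.Reasoning.Setoid as SetoidReasoning

parity-elim : ∀ {p} (P : ℕ → Set p) → (∀ n → P (2 * n)) → (∀ n → P (suc (2 * n))) → ∀ N → P N
parity-elim P even odd zero    = even 0
parity-elim P even odd (suc N) = parity-elim (P ∘ suc) odd (λ n → ≡.subst P (ℕ.*-suc 2 n) (even (suc n))) N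

≡ᵇ-refl : ∀ n → (n ≡ᵇ n) ≡ true
≡ᵇ-refl zero    = ≡.refl
≡ᵇ-refl (suc n) = ≡ᵇ-refl n

≤⇒≢ᵇsuc : ∀ {j n} → j ≤ n → (j ≡ᵇ suc n) ≡ false
≤⇒≢ᵇsuc {zero}  _         = ≡.refl
≤⇒≢ᵇsuc {suc j} (s≤s j≤n) = ≤⇒≢ᵇsuc j≤n

module _ {a} {A : Set a} where

  interleave : (ℕ → A) → (ℕ → A) → ℕ → A
  interleave e o zero    = e 0
  interleave e o (suc N) = interleave o (e ∘ suc) N

  interleave-even : ∀ (e o : ℕ → A) k → interleave e o (2 * k) ≡ e k
  interleave-even e o zero    = ≡.refl
  interleave-even e o (suc k) =
    ≡.trans (≡.cong (interleave e o) (ℕ.*-suc 2 k)) (interleave-even (e ∘ suc) (o ∘ suc) k)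

  interleave-odd : ∀ (e o : ℕ → A) k → interleave e o (suc (2 * k)) ≡ o k
  interleave-odd e o = interleave-even o (e ∘ suc)

  interleave-even-∸ : ∀ (e o : ℕ → A) n k → interleave e o (2 * n ∸ 2 * k) ≡ e (n ∸ k)
  interleave-even-∸ e o n k =
    ≡.trans (≡.cong (interleave e o) (≡.sym (ℕ.*-distribˡ-∸ 2 n k))) (interleave-even e o (n ∸ k))

  interleave-odd-∸ : ∀ (e o : ℕ → A) {n k} → k ≤ n → interleave e o (suc (2 * n) ∸ 2 * k) ≡ o (n ∸ k)
  interleave-odd-∸ e o {n} {k} k≤n = begin
    interleave e o (suc (2 * n) ∸ 2 * k)   ≡⟨ ≡.cong (interleave e o) (ℕ.+-∸-assoc 1 (ℕ.*-monoʳ-≤ 2 k≤n)) ⟩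
    interleave e o (suc (2 * n ∸ 2 * k))   ≡⟨ interleave-even-∸ o (e ∘ suc) n k ⟩
    o (n ∸ k)                              ∎
    where open ≡.≡-Reasoning

  interleave-odd-∸′ : ∀ (e o : ℕ → A) {n k} → k < n → interleave e o (2 * n ∸ suc (2 * k)) ≡ o (n ∸ suc k)
  interleave-odd-∸′ e o {suc n} {k} (s≤s k≤n) =
    ≡.trans (≡.cong (λ i → interleave e o (i ∸ suc (2 * k))) (ℕ.*-suc 2 n)) (interleave-odd-∸ e o k≤n)

module QSeries {c ℓ : Level} (R : CommutativeRing c ℓ) (q : CommutativeRing.Carrier R) where
  open CommutativeRing R renaming (_+_ to _⊕_; _*_ to _·_)
  open Q R q
  open import Algebra.Properties.Ring ring
    using (+-cancelˡ; -‿distribˡ-*; -‿distribʳ-*; -‿involutive; -‿+-comm; -‿anti-homo-+; -0#≈0#; -1*x≈-x;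
           xyx⁻¹≈y; x∙y⁻¹≈ε⇒x≈y)
  open import Algebra.Properties.CommutativeSemigroup +-commutativeSemigroup
    using (x∙yz≈y∙xz; x∙yz≈xz∙y; xy∙z≈xz∙y; interchange)
  open import Algebra.Solver.Ring.NaturalCoefficients.Default commutativeSemiring
  open SetoidReasoning setoid

  0·x·y≈0 : ∀ x y → 0# · x · y ≈ 0#
  0·x·y≈0 x y = trans (*-congʳ (zeroˡ x)) (zeroˡ y)

  x·0·y≈0 : ∀ x y → x · 0# · y ≈ 0#
  x·0·y≈0 x y = trans (*-congʳ (zeroʳ x)) (zeroˡ y)

  Σ<-cong : ∀ n {f g : ℕ → Carrier} → (∀ i → i < n → f i ≈ g i) → Σ< n f ≈ Σ< n g
  Σ<-cong zero    f≈g = refl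
  Σ<-cong (suc n) f≈g = +-cong (Σ<-cong n (λ i i<n → f≈g i (ℕ.m<n⇒m<1+n i<n))) (f≈g n ℕ.≤-refl)

  Σ<-zero : ∀ n {f : ℕ → Carrier} → (∀ i → i < n → f i ≈ 0#) → Σ< n f ≈ 0#
  Σ<-zero zero    f≈0 = refl
  Σ<-zero (suc n) f≈0 =
    trans (+-cong (Σ<-zero n (λ i i<n → f≈0 i (ℕ.m<n⇒m<1+n i<n))) (f≈0 n ℕ.≤-refl)) (+-identityʳ 0#)

  Σ<-distrib-⊕ : ∀ n (f g : ℕ → Carrier) → Σ< n (λ i → f i ⊕ g i) ≈ Σ< n f ⊕ Σ< n g
  Σ<-distrib-⊕ zero    f g = sym (+-identityʳ 0#)
  Σ<-distrib-⊕ (suc n) f g = trans (+-congʳ (Σ<-distrib-⊕ n f g)) (interchange _ _ _ _)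

  Σ<-distribˡ : ∀ n x (f : ℕ → Carrier) → x · Σ< n f ≈ Σ< n (λ i → x · f i)
  Σ<-distribˡ zero    x f = zeroʳ x
  Σ<-distribˡ (suc n) x f = trans (distribˡ x _ _) (+-congʳ (Σ<-distribˡ n x f))

  Σ<-neg : ∀ n (f : ℕ → Carrier) → Σ< n (λ i → - f i) ≈ - Σ< n f
  Σ<-neg zero    f = sym -0#≈0#
  Σ<-neg (suc n) f = trans (+-congʳ (Σ<-neg n f)) (-‿+-comm _ _)

  Σ<-head : ∀ n (f : ℕ → Carrier) → Σ< (suc n) f ≈ f 0 ⊕ Σ< n (f ∘ suc)
  Σ<-head zero    f = +-comm 0# (f 0)
  Σ<-head (suc n) f = trans (+-congʳ (Σ<-head n f)) (+-assoc _ _ _)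

  Σ<-pairs : ∀ n (f : ℕ → Carrier) → Σ< (2 * n) f ≈ Σ< n (λ k → f (2 * k) ⊕ f (suc (2 * k)))
  Σ<-pairs zero    f = refl
  Σ<-pairs (suc n) f = begin
    Σ< (2 * suc n) f                             ≡⟨ ≡.cong (λ m → Σ< m f) (ℕ.*-suc 2 n) ⟩
    Σ< (2 * n) f ⊕ f (2 * n) ⊕ f (suc (2 * n))    ≈⟨ +-assoc _ _ _ ⟩
    Σ< (2 * n) f ⊕ (f (2 * n) ⊕ f (suc (2 * n)))  ≈⟨ +-congʳ (Σ<-pairs n f) ⟩
    Σ< (suc n) (λ k → f (2 * k) ⊕ f (suc (2 * k))) ∎

  pow-+ : ∀ x m n → pow x (m + n) ≈ pow x m · pow x n
  pow-+ x zero    n = sym (*-identityˡ _)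
  pow-+ x (suc m) n = trans (*-congˡ (pow-+ x m n)) (sym (*-assoc _ _ _))

  pow-∸ : ∀ x {k n} → k ≤ n → pow x k · pow x (n ∸ k) ≈ pow x n
  pow-∸ x {k} {n} k≤n = trans (sym (pow-+ x k (n ∸ k))) (reflexive (≡.cong (pow x) (ℕ.m+[n∸m]≡n k≤n)))

  sgn-+ : ∀ m n → sgn (m + n) ≈ sgn m · sgn n
  sgn-+ zero    n = sym (*-identityˡ _)
  sgn-+ (suc m) n = trans (-‿cong (sgn-+ m n)) (-‿distribˡ-* _ _)

  sgn-square : ∀ n → sgn n · sgn n ≈ 1#
  sgn-square zero    = *-identityˡ 1#
  sgn-square (suc n) = begin
    - sgn n · - sgn n    ≈⟨ -‿distribˡ-* _ _ ⟨
    - (sgn n · - sgn n)  ≈⟨ -‿cong (-‿distribʳ-* _ _) ⟨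
    - - (sgn n · sgn n)  ≈⟨ -‿involutive _ ⟩
    sgn n · sgn n        ≈⟨ sgn-square n ⟩
    1#                   ∎

  sgn-even : ∀ k → sgn (2 * k) ≈ 1#
  sgn-even zero    = refl
  sgn-even (suc k) = trans (reflexive (≡.cong sgn (ℕ.*-suc 2 k))) (trans (-‿involutive _) (sgn-even k))

  sgn-∸ : ∀ {j n} → j ≤ n → sgn n · sgn (n ∸ j) ≈ sgn j
  sgn-∸ {j} {n} j≤n = begin
    sgn n · sgn (n ∸ j)                  ≡⟨ ≡.cong (λ m → sgn m · sgn (n ∸ j)) (ℕ.m+[n∸m]≡n j≤n) ⟨
    sgn (j + (n ∸ j)) · sgn (n ∸ j)      ≈⟨ *-congʳ (sgn-+ j (n ∸ j)) ⟩
    sgn j · sgn (n ∸ j) · sgn (n ∸ j)    ≈⟨ *-assoc _ _ _ ⟩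
    sgn j · (sgn (n ∸ j) · sgn (n ∸ j))  ≈⟨ *-congˡ (sgn-square (n ∸ j)) ⟩
    sgn j · 1#                           ≈⟨ *-identityʳ _ ⟩
    sgn j                                ∎

  qbin-zero : ∀ n → qbin n 0 ≡ 1#
  qbin-zero zero    = ≡.refl
  qbin-zero (suc n) = ≡.refl

  qbin-above : ∀ {n k} → n < k → qbin n k ≈ 0#
  qbin-above {zero}  {suc k} _         = refl
  qbin-above {suc n} {suc k} (s≤s n<k) = begin
    qbin n k ⊕ pow q (suc k) · qbin n (suc k)
      ≈⟨ +-cong (qbin-above n<k) (*-congˡ (qbin-above (ℕ.m<n⇒m<1+n n<k))) ⟩
    0# ⊕ pow q (suc k) · 0#
      ≈⟨ +-identityˡ _ ⟩
    pow q (suc k) · 0#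
      ≈⟨ zeroʳ _ ⟩
    0# ∎

  qbin-diag : ∀ n → qbin n n ≈ 1#
  qbin-diag zero    = refl
  qbin-diag (suc n) = begin
    qbin n n ⊕ pow q (suc n) · qbin n (suc n)  ≈⟨ +-cong (qbin-diag n) (*-congˡ (qbin-above {n} ℕ.≤-refl)) ⟩
    1# ⊕ pow q (suc n) · 0#                    ≈⟨ +-congˡ (zeroʳ _) ⟩
    1# ⊕ 0#                                    ≈⟨ +-identityʳ 1# ⟩
    1#                                         ∎

  qbin-pascalʳ : ∀ {n k} → k ≤ n → qbin (suc n) (suc k) ≈ pow q (n ∸ k) · qbin n k ⊕ qbin n (suc k)
  qbin-pascalʳ {zero}  z≤n = solve 1 (λ x → con 1 :+ (x :* con 1) :* con 0 := con 1 :* con 1 :+ con 0) refl q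
  qbin-pascalʳ {suc n} z≤n = begin
    1# ⊕ (q · 1#) · qbin (suc n) 1
      ≈⟨ +-congˡ (*-congˡ (trans (qbin-pascalʳ {n} z≤n) (+-congʳ (*-congˡ (reflexive (qbin-zero n)))))) ⟩
    1# ⊕ (q · 1#) · (pow q n · 1# ⊕ qbin n 1)
      ≈⟨ solve 3 (λ x p b → con 1 :+ (x :* con 1) :* (p :* con 1 :+ b) := (x :* p) :* con 1 :+ (con 1 :+ (x :* con 1) :* b))
           refl q (pow q n) (qbin n 1) ⟩
    pow q (suc n) · 1# ⊕ (1# ⊕ (q · 1#) · qbin n 1)
      ≡⟨ ≡.cong (λ x → pow q (suc n) · 1# ⊕ (x ⊕ (q · 1#) · qbin n 1)) (qbin-zero n) ⟨
    pow q (suc n) · qbin (suc n) 0 ⊕ qbin (suc n) 1 ∎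
  qbin-pascalʳ {suc n} {suc k} (s≤s k≤n) with ℕ.m≤n⇒m<n∨m≡n k≤n
  ... | inj₁ k<n = begin
    qbin (suc n) (suc k) ⊕ x · qbin (suc n) (suc (suc k))
      ≈⟨ +-cong (qbin-pascalʳ k≤n) (*-congˡ (qbin-pascalʳ k<n)) ⟩
    (a · A ⊕ B) ⊕ x · (b · B ⊕ C)
      ≈⟨ solve 6 (λ a A b B x C → (a :* A :+ B) :+ x :* (b :* B :+ C) := (a :* A :+ (x :* b) :* B) :+ (B :+ x :* C))
           refl a A b B x C ⟩
    (a · A ⊕ (x · b) · B) ⊕ (B ⊕ x · C)
      ≈⟨ +-congʳ (+-congˡ (*-congʳ exponents)) ⟩
    (a · A ⊕ (a · y) · B) ⊕ (B ⊕ x · C)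
      ≈⟨ +-congʳ (solve 4 (λ a A y B → a :* A :+ (a :* y) :* B := a :* (A :+ y :* B)) refl a A y B) ⟩
    a · (A ⊕ y · B) ⊕ (B ⊕ x · C) ∎
    where
    a b y x A B C : Carrier
    a = pow q (n ∸ k)
    b = pow q (n ∸ suc k)
    y = pow q (suc k)
    x = pow q (suc (suc k))
    A = qbin n k
    B = qbin n (suc k)
    C = qbin n (suc (suc k))
    exponents : x · b ≈ a · y
    exponents = begin
      q · y · b           ≈⟨ *-assoc _ _ _ ⟩
      q · (y · b)         ≈⟨ *-congˡ (pow-∸ q k<n) ⟩
      q · pow q n         ≈⟨ *-congˡ (pow-∸ q k≤n) ⟨
      q · (pow q k · a)   ≈⟨ solve 3 (λ q p a → q :* (p :* a) := a :* (q :* p)) refl q (pow q k) a ⟩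
      a · y               ∎
  ... | inj₂ ≡.refl = begin
    qbin (suc n) (suc n) ⊕ pow q (suc (suc n)) · qbin (suc n) (suc (suc n))
      ≈⟨ +-cong (qbin-diag (suc n)) (*-congˡ (qbin-above {suc n} ℕ.≤-refl)) ⟩
    1# ⊕ pow q (suc (suc n)) · 0#
      ≈⟨ solve 1 (λ x → con 1 :+ x :* con 0 := con 1 :* con 1 :+ con 0) refl (pow q (suc (suc n))) ⟩
    1# · 1# ⊕ 0#
      ≈⟨ +-cong (*-cong (reflexive (≡.cong (pow q) (ℕ.n∸n≡0 n))) (qbin-diag (suc n))) (qbin-above {suc n} ℕ.≤-refl) ⟨
    pow q (n ∸ n) · qbin (suc n) (suc n) ⊕ qbin (suc n) (suc (suc n)) ∎

  Seq : Set c
  Seq = ℕ → Carrier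

  infix 4 _≋_
  _≋_ : Seq → Seq → Set ℓ
  f ≋ g = ∀ i → f i ≈ g i

  infixl 6 _⊞_
  _⊞_ : Seq → Seq → Seq
  (f ⊞ g) i = f i ⊕ g i

  ⊟_ : Seq → Seq
  (⊟ f) i = - f i

  δ : Seq
  δ zero    = 1#
  δ (suc _) = 0#

  infixl 7 _⋆_
  _⋆_ : Seq → Seq → Seq
  (f ⋆ g) N = Σ< (suc N) (λ i → qbin N i · f i · g (N ∸ i))

  -- On generating functions, shift is the q-derivative F ↦ (F(x) - F(qx)) / x and dilate is F ↦ F(qx).
  shift : Seq → Seq
  shift f = f ∘ suc

  dilate : Seq → Seq
  dilate f i = pow q i · f i

  ⋆-congʳ : ∀ h {f f′} → f ≋ f′ → f ⋆ h ≋ f′ ⋆ h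
  ⋆-congʳ h f≋f′ N = Σ<-cong (suc N) (λ i _ → *-congʳ (*-congˡ (f≋f′ i)))

  ⋆-congˡ : ∀ h {g g′} → g ≋ g′ → h ⋆ g ≋ h ⋆ g′
  ⋆-congˡ h g≋g′ N = Σ<-cong (suc N) (λ i _ → *-congˡ (g≋g′ (N ∸ i)))

  ⋆-distribʳ-⊞ : ∀ f g h → (f ⊞ g) ⋆ h ≋ f ⋆ h ⊞ g ⋆ h
  ⋆-distribʳ-⊞ f g h N =
    trans (Σ<-cong (suc N) (λ i _ → trans (*-congʳ (distribˡ _ _ _)) (distribʳ _ _ _))) (Σ<-distrib-⊕ (suc N) _ _)

  ⋆-distribˡ-⊞ : ∀ f g h → f ⋆ (g ⊞ h) ≋ f ⋆ g ⊞ f ⋆ h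
  ⋆-distribˡ-⊞ f g h N = trans (Σ<-cong (suc N) (λ i _ → distribˡ _ _ _)) (Σ<-distrib-⊕ (suc N) _ _)

  ⋆-negˡ : ∀ f g → (⊟ f) ⋆ g ≋ ⊟ (f ⋆ g)
  ⋆-negˡ f g N =
    trans (Σ<-cong (suc N) (λ i _ → trans (*-congʳ (sym (-‿distribʳ-* _ _))) (sym (-‿distribˡ-* _ _)))) (Σ<-neg (suc N) _)

  ⋆-identityˡ : ∀ f → δ ⋆ f ≋ f
  ⋆-identityˡ f N = begin
    (δ ⋆ f) N
      ≈⟨ Σ<-head N _ ⟩
    qbin N 0 · 1# · f N ⊕ Σ< N (λ i → qbin N (suc i) · 0# · f (N ∸ suc i))
      ≈⟨ +-cong (*-congʳ (trans (*-identityʳ _) (reflexive (qbin-zero N)))) (Σ<-zero N (λ i _ → x·0·y≈0 _ _)) ⟩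
    1# · f N ⊕ 0#
      ≈⟨ +-identityʳ _ ⟩
    1# · f N
      ≈⟨ *-identityˡ _ ⟩
    f N ∎

  dilate-⋆ : ∀ f g → dilate f ⋆ dilate g ≋ dilate (f ⋆ g)
  dilate-⋆ f g N = trans (Σ<-cong (suc N) factor) (sym (Σ<-distribˡ (suc N) (pow q N) _))
    where
    factor : ∀ i → i < suc N →
      qbin N i · (pow q i · f i) · (pow q (N ∸ i) · g (N ∸ i)) ≈ pow q N · (qbin N i · f i · g (N ∸ i))
    factor i i<1+N = begin
      qbin N i · (pow q i · f i) · (pow q (N ∸ i) · g (N ∸ i))
        ≈⟨ solve 5 (λ b p x r y → b :* (p :* x) :* (r :* y) := (p :* r) :* (b :* x :* y))
             refl (qbin N i) (pow q i) (f i) (pow q (N ∸ i)) (g (N ∸ i)) ⟩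
      pow q i · pow q (N ∸ i) · (qbin N i · f i · g (N ∸ i))
        ≈⟨ *-congʳ (pow-∸ q (ℕ.m<1+n⇒m≤n i<1+N)) ⟩
      pow q N · (qbin N i · f i · g (N ∸ i)) ∎

  shift-⋆-dilateˡ : ∀ f g → shift (f ⋆ g) ≋ shift f ⋆ g ⊞ dilate f ⋆ shift g
  shift-⋆-dilateˡ f g N = begin
    (f ⋆ g) (suc N)
      ≈⟨ Σ<-head (suc N) _ ⟩
    1# · f 0 · g (suc N) ⊕ Σ< (suc N) (λ j → (qbin N j ⊕ pow q (suc j) · qbin N (suc j)) · f (suc j) · g (N ∸ j))
      ≈⟨ +-congˡ (trans (Σ<-cong (suc N) (λ j _ → split j)) (Σ<-distrib-⊕ (suc N) _ G)) ⟩
    1# · f 0 · g (suc N) ⊕ ((shift f ⋆ g) N ⊕ Σ< (suc N) G)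
      ≈⟨ +-congˡ (+-congˡ (trans (+-congˡ G-last) (+-identityʳ _))) ⟩
    1# · f 0 · g (suc N) ⊕ ((shift f ⋆ g) N ⊕ Σ< N G)
      ≈⟨ x∙yz≈y∙xz _ _ _ ⟩
    (shift f ⋆ g) N ⊕ (1# · f 0 · g (suc N) ⊕ Σ< N G)
      ≈⟨ +-congˡ (+-cong head (Σ<-cong N G≈H)) ⟩
    (shift f ⋆ g) N ⊕ (H 0 ⊕ Σ< N (H ∘ suc))
      ≈⟨ +-congˡ (Σ<-head N H) ⟨
    (shift f ⋆ g) N ⊕ (dilate f ⋆ shift g) N
      ∎
    where
    G H : Seq
    G j = qbin N (suc j) · (pow q (suc j) · f (suc j)) · g (N ∸ j)
    H i = qbin N i · (pow q i · f i) · g (suc (N ∸ i))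
    split : ∀ j → (qbin N j ⊕ pow q (suc j) · qbin N (suc j)) · f (suc j) · g (N ∸ j) ≈
                  qbin N j · f (suc j) · g (N ∸ j) ⊕ G j
    split j = solve 5 (λ a p b x z → (a :+ p :* b) :* x :* z := a :* x :* z :+ b :* (p :* x) :* z) refl
                (qbin N j) (pow q (suc j)) (qbin N (suc j)) (f (suc j)) (g (N ∸ j))
    G-last : G N ≈ 0#
    G-last = trans (*-congʳ (*-congʳ (qbin-above {N} ℕ.≤-refl))) (0·x·y≈0 _ _)
    head : 1# · f 0 · g (suc N) ≈ H 0
    head = *-congʳ (trans (*-congˡ (sym (*-identityˡ _))) (*-congʳ (reflexive (≡.sym (qbin-zero N)))))
    G≈H : ∀ j → j < N → G j ≈ H (suc j)
    G≈H j j<N = *-congˡ (reflexive (≡.cong g (ℕ.+-∸-assoc 1 j<N)))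

  shift-⋆-dilateʳ : ∀ f g → shift (f ⋆ g) ≋ f ⋆ shift g ⊞ shift f ⋆ dilate g
  shift-⋆-dilateʳ f g N = begin
    (f ⋆ g) (suc N)
      ≈⟨ Σ<-head (suc N) _ ⟩
    1# · f 0 · g (suc N) ⊕ Σ< (suc N) (λ j → qbin (suc N) (suc j) · f (suc j) · g (N ∸ j))
      ≈⟨ +-congˡ (trans (Σ<-cong (suc N) split) (Σ<-distrib-⊕ (suc N) _ L)) ⟩
    1# · f 0 · g (suc N) ⊕ ((shift f ⋆ dilate g) N ⊕ Σ< (suc N) L)
      ≈⟨ +-congˡ (+-congˡ (trans (+-congˡ L-last) (+-identityʳ _))) ⟩
    1# · f 0 · g (suc N) ⊕ ((shift f ⋆ dilate g) N ⊕ Σ< N L)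
      ≈⟨ x∙yz≈xz∙y _ _ _ ⟩
    (1# · f 0 · g (suc N) ⊕ Σ< N L) ⊕ (shift f ⋆ dilate g) N
      ≈⟨ +-congʳ (+-cong head (Σ<-cong N L≈H)) ⟩
    (H 0 ⊕ Σ< N (H ∘ suc)) ⊕ (shift f ⋆ dilate g) N
      ≈⟨ +-congʳ (Σ<-head N H) ⟨
    (f ⋆ shift g) N ⊕ (shift f ⋆ dilate g) N
      ∎
    where
    H L : Seq
    H i = qbin N i · f i · g (suc (N ∸ i))
    L j = qbin N (suc j) · f (suc j) · g (N ∸ j)
    split : ∀ j → j < suc N → qbin (suc N) (suc j) · f (suc j) · g (N ∸ j) ≈
                              qbin N j · f (suc j) · (pow q (N ∸ j) · g (N ∸ j)) ⊕ L j
    split j j<1+N = trans (*-congʳ (*-congʳ (qbin-pascalʳ (ℕ.m<1+n⇒m≤n j<1+N))))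
      (solve 5 (λ p a b x z → (p :* a :+ b) :* x :* z := a :* x :* (p :* z) :+ b :* x :* z) refl
         (pow q (N ∸ j)) (qbin N j) (qbin N (suc j)) (f (suc j)) (g (N ∸ j)))
    L-last : L N ≈ 0#
    L-last = trans (*-congʳ (*-congʳ (qbin-above {N} ℕ.≤-refl))) (0·x·y≈0 _ _)
    head : 1# · f 0 · g (suc N) ≈ H 0
    head = *-congʳ (*-congʳ (reflexive (≡.sym (qbin-zero N))))
    L≈H : ∀ j → j < N → L j ≈ H (suc j)
    L≈H j j<N = *-congˡ (reflexive (≡.cong g (ℕ.+-∸-assoc 1 j<N)))

  ⋆-assoc : ∀ f g h → (f ⋆ g) ⋆ h ≋ f ⋆ (g ⋆ h)
  ⋆-assoc f g h zero =
    solve 3 (λ a b c → con 0 :+ con 1 :* (con 0 :+ con 1 :* a :* b) :* c := con 0 :+ con 1 :* a :* (con 0 :+ con 1 :* b :* c))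
      refl (f 0) (g 0) (h 0)
  ⋆-assoc f g h (suc N) = begin
    (f ⋆ g ⋆ h) (suc N)
      ≈⟨ shift-⋆-dilateˡ (f ⋆ g) h N ⟩
    (shift (f ⋆ g) ⋆ h) N ⊕ (dilate (f ⋆ g) ⋆ shift h) N
      ≈⟨ +-cong (⋆-congʳ h (shift-⋆-dilateˡ f g) N) (⋆-congʳ (shift h) (λ i → sym (dilate-⋆ f g i)) N) ⟩
    ((shift f ⋆ g ⊞ dilate f ⋆ shift g) ⋆ h) N ⊕ (dilate f ⋆ dilate g ⋆ shift h) N
      ≈⟨ +-congʳ (⋆-distribʳ-⊞ (shift f ⋆ g) (dilate f ⋆ shift g) h N) ⟩
    (shift f ⋆ g ⋆ h) N ⊕ (dilate f ⋆ shift g ⋆ h) N ⊕ (dilate f ⋆ dilate g ⋆ shift h) N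
      ≈⟨ +-cong (+-cong (⋆-assoc (shift f) g h N) (⋆-assoc (dilate f) (shift g) h N))
                (⋆-assoc (dilate f) (dilate g) (shift h) N) ⟩
    (shift f ⋆ (g ⋆ h)) N ⊕ (dilate f ⋆ (shift g ⋆ h)) N ⊕ (dilate f ⋆ (dilate g ⋆ shift h)) N
      ≈⟨ +-assoc _ _ _ ⟩
    (shift f ⋆ (g ⋆ h)) N ⊕ ((dilate f ⋆ (shift g ⋆ h)) N ⊕ (dilate f ⋆ (dilate g ⋆ shift h)) N)
      ≈⟨ +-congˡ (⋆-distribˡ-⊞ (dilate f) (shift g ⋆ h) (dilate g ⋆ shift h) N) ⟨
    (shift f ⋆ (g ⋆ h)) N ⊕ (dilate f ⋆ (shift g ⋆ h ⊞ dilate g ⋆ shift h)) N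
      ≈⟨ +-congˡ (⋆-congˡ (dilate f) (λ i → sym (shift-⋆-dilateˡ g h i)) N) ⟩
    (shift f ⋆ (g ⋆ h)) N ⊕ (dilate f ⋆ shift (g ⋆ h)) N
      ≈⟨ shift-⋆-dilateˡ f (g ⋆ h) N ⟨
    (f ⋆ (g ⋆ h)) (suc N)
      ∎

  ⋆-comm : ∀ f g → f ⋆ g ≋ g ⋆ f
  ⋆-comm f g zero    = solve 2 (λ a b → con 0 :+ con 1 :* a :* b := con 0 :+ con 1 :* b :* a) refl (f 0) (g 0)
  ⋆-comm f g (suc N) = begin
    (f ⋆ g) (suc N)                           ≈⟨ shift-⋆-dilateˡ f g N ⟩
    (shift f ⋆ g) N ⊕ (dilate f ⋆ shift g) N  ≈⟨ +-cong (⋆-comm (shift f) g N) (⋆-comm (dilate f) (shift g) N) ⟩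
    (g ⋆ shift f) N ⊕ (shift g ⋆ dilate f) N  ≈⟨ shift-⋆-dilateʳ g f N ⟨
    (g ⋆ f) (suc N)                           ∎

  ⋆-cancelʳ : ∀ {f h} g → g 0 ≈ 1# → f ⋆ g ≋ h ⋆ g → f ≋ h
  ⋆-cancelʳ {f} {h} g g₀≈1 fg≋hg = <-rec _ step
    where
    last : ∀ N (u : Seq) → qbin N N · u N · g (N ∸ N) ≈ u N
    last N u = begin
      qbin N N · u N · g (N ∸ N)
        ≈⟨ *-cong (*-congʳ (qbin-diag N)) (trans (reflexive (≡.cong g (ℕ.n∸n≡0 N))) g₀≈1) ⟩
      1# · u N · 1#
        ≈⟨ *-identityʳ _ ⟩
      1# · u N
        ≈⟨ *-identityˡ _ ⟩
      u N ∎
    step : ∀ N → (∀ {i} → i < N → f i ≈ h i) → f N ≈ h N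
    step N ih = begin
      f N                           ≈⟨ last N f ⟨
      qbin N N · f N · g (N ∸ N)    ≈⟨ +-cancelˡ (Σ< N (λ i → qbin N i · f i · g (N ∸ i))) _ _ sums ⟩
      qbin N N · h N · g (N ∸ N)    ≈⟨ last N h ⟩
      h N                           ∎
      where
      sums : (f ⋆ g) N ≈ Σ< N (λ i → qbin N i · f i · g (N ∸ i)) ⊕ qbin N N · h N · g (N ∸ N)
      sums = trans (fg≋hg N) (+-congʳ (Σ<-cong N (λ i i<N → *-congʳ (*-congˡ (sym (ih i<N))))))

  ⋆-even : ∀ f g n → (f ⋆ g) (2 * n) ≈
    Σ< (suc n) (λ k → qbin (2 * n) (2 * k) · f (2 * k) · g (2 * n ∸ 2 * k)) ⊕
    Σ< n (λ k → qbin (2 * n) (suc (2 * k)) · f (suc (2 * k)) · g (2 * n ∸ suc (2 * k)))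
  ⋆-even f g n = begin
    Σ< (2 * n) T ⊕ T (2 * n)                                         ≈⟨ +-congʳ (Σ<-pairs n T) ⟩
    Σ< n (λ k → T (2 * k) ⊕ T (suc (2 * k))) ⊕ T (2 * n)             ≈⟨ +-congʳ (Σ<-distrib-⊕ n _ _) ⟩
    Σ< n (T ∘ (2 *_)) ⊕ Σ< n (T ∘ suc ∘ (2 *_)) ⊕ T (2 * n)          ≈⟨ xy∙z≈xz∙y _ _ _ ⟩
    Σ< (suc n) (T ∘ (2 *_)) ⊕ Σ< n (T ∘ suc ∘ (2 *_))                ∎
    where
    T : ℕ → Carrier
    T i = qbin (2 * n) i · f i · g (2 * n ∸ i)

  ⋆-odd : ∀ f g n → (f ⋆ g) (suc (2 * n)) ≈
    Σ< (suc n) (λ k → qbin (suc (2 * n)) (2 * k) · f (2 * k) · g (suc (2 * n) ∸ 2 * k) ⊕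
                      qbin (suc (2 * n)) (suc (2 * k)) · f (suc (2 * k)) · g (2 * n ∸ 2 * k))
  ⋆-odd f g n = begin
    Σ< (suc (suc (2 * n))) T   ≡⟨ ≡.cong (λ m → Σ< m T) (ℕ.*-suc 2 n) ⟨
    Σ< (2 * suc n) T           ≈⟨ Σ<-pairs (suc n) T ⟩
    Σ< (suc n) (λ k → T (2 * k) ⊕ T (suc (2 * k))) ∎
    where
    T : ℕ → Carrier
    T i = qbin (suc (2 * n)) i · f i · g (suc (2 * n) ∸ i)

  ⋆-interleave-even : ∀ fₑ fₒ gₑ gₒ n → (interleave fₑ fₒ ⋆ interleave gₑ gₒ) (2 * n) ≈
    Σ< (suc n) (λ k → qbin (2 * n) (2 * k) · fₑ k · gₑ (n ∸ k)) ⊕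
    Σ< n (λ k → qbin (2 * n) (suc (2 * k)) · fₒ k · gₒ (n ∸ suc k))
  ⋆-interleave-even fₑ fₒ gₑ gₒ n = trans (⋆-even (interleave fₑ fₒ) (interleave gₑ gₒ) n) (+-cong
    (Σ<-cong (suc n) (λ k _ → reflexive (≡.cong₂ (λ x y → qbin (2 * n) (2 * k) · x · y)
      (interleave-even fₑ fₒ k) (interleave-even-∸ gₑ gₒ n k))))
    (Σ<-cong n (λ k k<n → reflexive (≡.cong₂ (λ x y → qbin (2 * n) (suc (2 * k)) · x · y)
      (interleave-odd fₑ fₒ k) (interleave-odd-∸′ gₑ gₒ k<n)))))

  ⋆-interleave-odd : ∀ fₑ fₒ gₑ gₒ n → (interleave fₑ fₒ ⋆ interleave gₑ gₒ) (suc (2 * n)) ≈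
    Σ< (suc n) (λ k → qbin (suc (2 * n)) (2 * k) · fₑ k · gₒ (n ∸ k) ⊕
                      qbin (suc (2 * n)) (suc (2 * k)) · fₒ k · gₑ (n ∸ k))
  ⋆-interleave-odd fₑ fₒ gₑ gₒ n = trans (⋆-odd (interleave fₑ fₒ) (interleave gₑ gₒ) n)
    (Σ<-cong (suc n) (λ k k<1+n → reflexive (≡.cong₂ _⊕_
      (≡.cong₂ (λ x y → qbin (suc (2 * n)) (2 * k) · x · y)
        (interleave-even fₑ fₒ k) (interleave-odd-∸ gₑ gₒ (ℕ.m<1+n⇒m≤n k<1+n)))
      (≡.cong₂ (λ x y → qbin (suc (2 * n)) (suc (2 * k)) · x · y)
        (interleave-odd fₑ fₒ k) (interleave-even-∸ gₑ gₒ n k)))))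

  tanTable-stable : ∀ {n j} → j ≤ n → tanTable n j ≡ E j
  tanTable-stable {zero}  z≤n = ≡.refl
  tanTable-stable {suc n} j≤1+n with ℕ.m≤n⇒m<n∨m≡n j≤1+n
  ... | inj₂ ≡.refl    = ≡.refl
  ... | inj₁ (s≤s j≤n) rewrite ≤⇒≢ᵇsuc j≤n = tanTable-stable j≤n

  E-suc : ∀ m →
    E (suc m) ≈ sgn (suc m) ⊕ - Σ< (suc m) (λ j → sgn (suc m ∸ j) · qbin (suc (2 * suc m)) (suc (2 * j)) · E j)
  E-suc m rewrite ≡ᵇ-refl m =
    +-congˡ (-‿cong (Σ<-cong (suc m) (λ j j<1+m → *-congˡ (reflexive (tanTable-stable (ℕ.m<1+n⇒m≤n j<1+m))))))

  tangent-recurrence : ∀ n → Σ< (suc n) (λ k → qbin (suc (2 * n)) (suc (2 * k)) · (sgn k · E k)) ≈ 1#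
  tangent-recurrence zero    =
    solve 1 (λ x → con 0 :+ (con 1 :+ (x :* con 1) :* con 0) :* (con 1 :* con 1) := con 1) refl q
  tangent-recurrence (suc m) = begin
    Σ< (suc m) W ⊕ qbin N N · (sgn (suc m) · E (suc m))  ≈⟨ +-congˡ (trans (*-congʳ (qbin-diag N)) (*-identityˡ _)) ⟩
    Σ< (suc m) W ⊕ sgn (suc m) · E (suc m)               ≈⟨ +-congˡ last ⟩
    Σ< (suc m) W ⊕ (1# ⊕ - Σ< (suc m) W)                 ≈⟨ x∙yz≈y∙xz _ _ _ ⟩
    1# ⊕ (Σ< (suc m) W ⊕ - Σ< (suc m) W)                 ≈⟨ +-congˡ (-‿inverseʳ _) ⟩
    1# ⊕ 0#                                              ≈⟨ +-identityʳ 1# ⟩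
    1#                                                   ∎
    where
    N : ℕ
    N = suc (2 * suc m)
    W : ℕ → Carrier
    W k = qbin N (suc (2 * k)) · (sgn k · E k)
    V : ℕ → Carrier
    V j = sgn (suc m ∸ j) · qbin N (suc (2 * j)) · E j
    sgn·V : ∀ j → j < suc m → sgn (suc m) · V j ≈ W j
    sgn·V j j<1+m = begin
      sgn (suc m) · (sgn (suc m ∸ j) · qbin N (suc (2 * j)) · E j)
        ≈⟨ solve 4 (λ s t b e → s :* (t :* b :* e) := b :* ((s :* t) :* e))
             refl (sgn (suc m)) (sgn (suc m ∸ j)) (qbin N (suc (2 * j))) (E j) ⟩
      qbin N (suc (2 * j)) · (sgn (suc m) · sgn (suc m ∸ j) · E j)
        ≈⟨ *-congˡ (*-congʳ (sgn-∸ (ℕ.<⇒≤ j<1+m))) ⟩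
      W j ∎
    last : sgn (suc m) · E (suc m) ≈ 1# ⊕ - Σ< (suc m) W
    last = begin
      sgn (suc m) · E (suc m)
        ≈⟨ *-congˡ (E-suc m) ⟩
      sgn (suc m) · (sgn (suc m) ⊕ - Σ< (suc m) V)
        ≈⟨ distribˡ _ _ _ ⟩
      sgn (suc m) · sgn (suc m) ⊕ sgn (suc m) · - Σ< (suc m) V
        ≈⟨ +-cong (sgn-square (suc m)) (sym (-‿distribʳ-* _ _)) ⟩
      1# ⊕ - (sgn (suc m) · Σ< (suc m) V)
        ≈⟨ +-congˡ (-‿cong (trans (Σ<-distribˡ (suc m) _ V) (Σ<-cong (suc m) sgn·V))) ⟩
      1# ⊕ - Σ< (suc m) W ∎

  cosh sinh tanh : Seq
  cosh = interleave (const 1#) (const 0#)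
  sinh = interleave (const 0#) (const 1#)
  tanh = interleave (const 0#) (λ k → sgn k · E k)

  tanh⋆cosh : tanh ⋆ cosh ≋ sinh
  tanh⋆cosh = parity-elim _ even odd
    where
    even : ∀ n → (tanh ⋆ cosh) (2 * n) ≈ sinh (2 * n)
    even n = begin
      (tanh ⋆ cosh) (2 * n)
        ≈⟨ ⋆-interleave-even _ _ _ _ n ⟩
      Σ< (suc n) (λ k → qbin (2 * n) (2 * k) · 0# · 1#) ⊕
      Σ< n (λ k → qbin (2 * n) (suc (2 * k)) · (sgn k · E k) · 0#)
        ≈⟨ +-cong (Σ<-zero (suc n) (λ _ _ → x·0·y≈0 _ _)) (Σ<-zero n (λ _ _ → zeroʳ _)) ⟩
      0# ⊕ 0#
        ≈⟨ +-identityʳ 0# ⟩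
      0#
        ≡⟨ interleave-even (const 0#) (const 1#) n ⟨
      sinh (2 * n) ∎
    odd : ∀ n → (tanh ⋆ cosh) (suc (2 * n)) ≈ sinh (suc (2 * n))
    odd n = begin
      (tanh ⋆ cosh) (suc (2 * n))
        ≈⟨ ⋆-interleave-odd _ _ _ _ n ⟩
      Σ< (suc n) (λ k → qbin (suc (2 * n)) (2 * k) · 0# · 0# ⊕
                        qbin (suc (2 * n)) (suc (2 * k)) · (sgn k · E k) · 1#)
        ≈⟨ Σ<-cong (suc n) (λ _ _ → trans (+-cong (zeroʳ _) (*-identityʳ _)) (+-identityˡ _)) ⟩
      Σ< (suc n) (λ k → qbin (suc (2 * n)) (suc (2 * k)) · (sgn k · E k))
        ≈⟨ tangent-recurrence n ⟩
      1#
        ≡⟨ interleave-odd (const 0#) (const 1#) n ⟨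
      sinh (suc (2 * n)) ∎

  negPoch₋₁ : Seq
  negPoch₋₁ zero    = 0#
  negPoch₋₁ (suc N) = negPoch N

  evenPart oddPart : Seq → Seq
  evenPart f = interleave (f ∘ (2 *_)) (const 0#)
  oddPart  f = interleave (const 0#) (f ∘ suc ∘ (2 *_))

  signedNegPoch₋₁ : Seq
  signedNegPoch₋₁ i = sgn i · negPoch₋₁ i

  signedNegPoch₋₁-q-difference : shift signedNegPoch₋₁ ⊞ dilate signedNegPoch₋₁ ≋ ⊟ (δ ⊞ signedNegPoch₋₁)
  signedNegPoch₋₁-q-difference zero = begin
    - 1# · 1# ⊕ 1# · (1# · 0#)  ≈⟨ +-cong (*-identityʳ _) (trans (*-congˡ (zeroʳ 1#)) (zeroʳ 1#)) ⟩
    - 1# ⊕ 0#                   ≈⟨ +-identityʳ _ ⟩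
    - 1#                        ≈⟨ -‿cong (trans (+-congˡ (zeroʳ 1#)) (+-identityʳ 1#)) ⟨
    - (1# ⊕ 1# · 0#)            ∎
  signedNegPoch₋₁-q-difference (suc j) = begin
    - - s · (p · (1# ⊕ w)) ⊕ w · (- s · p)
      ≈⟨ +-cong (*-congʳ (-‿involutive s)) (*-congˡ (sym (-‿distribˡ-* s p))) ⟩
    s · (p · (1# ⊕ w)) ⊕ w · - (s · p)
      ≈⟨ +-cong (solve 3 (λ s p w → s :* (p :* (con 1 :+ w)) := w :* (s :* p) :+ s :* p) refl s p w)
                (sym (-‿distribʳ-* w _)) ⟩
    w · (s · p) ⊕ s · p ⊕ - (w · (s · p))
      ≈⟨ xyx⁻¹≈y _ _ ⟩
    s · p
      ≈⟨ -‿involutive _ ⟨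
    - - (s · p)
      ≈⟨ -‿cong (trans (-‿distribˡ-* s p) (sym (+-identityˡ _))) ⟩
    - (0# ⊕ - s · p) ∎
    where
    s p w : Carrier
    s = sgn j
    p = negPoch j
    w = pow q (suc j)

  signedNegPoch₋₁⋆1-suc : ∀ N → (signedNegPoch₋₁ ⋆ const 1#) (suc N) ≈ - (1# ⊕ (signedNegPoch₋₁ ⋆ const 1#) N)
  signedNegPoch₋₁⋆1-suc N = begin
    (ν ⋆ const 1#) (suc N)                            ≈⟨ shift-⋆-dilateˡ ν (const 1#) N ⟩
    (shift ν ⋆ const 1#) N ⊕ (dilate ν ⋆ const 1#) N  ≈⟨ ⋆-distribʳ-⊞ (shift ν) (dilate ν) (const 1#) N ⟨
    ((shift ν ⊞ dilate ν) ⋆ const 1#) N               ≈⟨ ⋆-congʳ (const 1#) signedNegPoch₋₁-q-difference N ⟩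
    ((⊟ (δ ⊞ ν)) ⋆ const 1#) N                        ≈⟨ ⋆-negˡ (δ ⊞ ν) (const 1#) N ⟩
    - ((δ ⊞ ν) ⋆ const 1#) N                          ≈⟨ -‿cong (⋆-distribʳ-⊞ δ ν (const 1#) N) ⟩
    - ((δ ⋆ const 1#) N ⊕ (ν ⋆ const 1#) N)           ≈⟨ -‿cong (+-congʳ (⋆-identityˡ (const 1#) N)) ⟩
    - (1# ⊕ (ν ⋆ const 1#) N)                         ∎
    where
    ν : Seq
    ν = signedNegPoch₋₁

  signedNegPoch₋₁⋆1-even : ∀ n → (signedNegPoch₋₁ ⋆ const 1#) (2 * n) ≈ 0#
  signedNegPoch₋₁⋆1-even zero    = trans (+-identityˡ _) (trans (*-identityʳ _) (trans (*-identityˡ _) (zeroʳ 1#)))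
  signedNegPoch₋₁⋆1-even (suc n) = begin
    u (2 * suc n)                ≡⟨ ≡.cong u (ℕ.*-suc 2 n) ⟩
    u (suc (suc (2 * n)))        ≈⟨ signedNegPoch₋₁⋆1-suc (suc (2 * n)) ⟩
    - (1# ⊕ u (suc (2 * n)))     ≈⟨ -‿cong (+-congˡ (signedNegPoch₋₁⋆1-suc (2 * n))) ⟩
    - (1# ⊕ - (1# ⊕ u (2 * n)))  ≈⟨ -‿anti-homo-+ _ _ ⟩
    - - (1# ⊕ u (2 * n)) ⊕ - 1#  ≈⟨ +-congʳ (-‿involutive _) ⟩
    1# ⊕ u (2 * n) ⊕ - 1#        ≈⟨ xyx⁻¹≈y _ _ ⟩
    u (2 * n)                    ≈⟨ signedNegPoch₋₁⋆1-even n ⟩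
    0#                           ∎
    where
    u : Seq
    u = signedNegPoch₋₁ ⋆ const 1#

  alternating-sum : ∀ n → Σ< (suc n) (λ k → qbin (2 * n) (2 * k) · negPoch₋₁ (2 * k)) ≈
                          Σ< n (λ k → qbin (2 * n) (suc (2 * k)) · negPoch (2 * k))
  alternating-sum n = x∙y⁻¹≈ε⇒x≈y _ _ (begin
    Σ< (suc n) (λ k → qbin (2 * n) (2 * k) · negPoch₋₁ (2 * k)) ⊕
    - Σ< n (λ k → qbin (2 * n) (suc (2 * k)) · negPoch (2 * k))
      ≈⟨ +-cong (Σ<-cong (suc n) (λ k _ → even k)) (trans (Σ<-cong n (λ k _ → odd k)) (Σ<-neg n _)) ⟨
    Σ< (suc n) (λ k → qbin (2 * n) (2 * k) · ν (2 * k) · 1#) ⊕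
    Σ< n (λ k → qbin (2 * n) (suc (2 * k)) · ν (suc (2 * k)) · 1#)
      ≈⟨ ⋆-even ν (const 1#) n ⟨
    (ν ⋆ const 1#) (2 * n)
      ≈⟨ signedNegPoch₋₁⋆1-even n ⟩
    0# ∎)
    where
    ν : Seq
    ν = signedNegPoch₋₁
    even : ∀ k → qbin (2 * n) (2 * k) · ν (2 * k) · 1# ≈ qbin (2 * n) (2 * k) · negPoch₋₁ (2 * k)
    even k = trans (*-identityʳ _) (*-congˡ (trans (*-congʳ (sgn-even k)) (*-identityˡ _)))
    odd : ∀ k → qbin (2 * n) (suc (2 * k)) · ν (suc (2 * k)) · 1# ≈ - (qbin (2 * n) (suc (2 * k)) · negPoch (2 * k))
    odd k = trans (*-identityʳ _)
      (trans (*-congˡ (trans (*-congʳ (-‿cong (sgn-even k))) (-1*x≈-x _))) (sym (-‿distribʳ-* _ _)))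

  oddPart⋆sinh : oddPart negPoch₋₁ ⋆ sinh ≋ evenPart negPoch₋₁ ⋆ cosh
  oddPart⋆sinh = parity-elim _ even odd
    where
    even : ∀ n → (oddPart negPoch₋₁ ⋆ sinh) (2 * n) ≈ (evenPart negPoch₋₁ ⋆ cosh) (2 * n)
    even n = begin
      (oddPart negPoch₋₁ ⋆ sinh) (2 * n)
        ≈⟨ ⋆-interleave-even _ _ _ _ n ⟩
      Σ< (suc n) (λ k → qbin (2 * n) (2 * k) · 0# · 0#) ⊕
      Σ< n (λ k → qbin (2 * n) (suc (2 * k)) · negPoch (2 * k) · 1#)
        ≈⟨ +-cong (Σ<-zero (suc n) (λ _ _ → zeroʳ _)) (Σ<-cong n (λ _ _ → *-identityʳ _)) ⟩
      0# ⊕ Σ< n (λ k → qbin (2 * n) (suc (2 * k)) · negPoch (2 * k))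
        ≈⟨ +-identityˡ _ ⟩
      Σ< n (λ k → qbin (2 * n) (suc (2 * k)) · negPoch (2 * k))
        ≈⟨ alternating-sum n ⟨
      Σ< (suc n) (λ k → qbin (2 * n) (2 * k) · negPoch₋₁ (2 * k))
        ≈⟨ +-identityʳ _ ⟨
      Σ< (suc n) (λ k → qbin (2 * n) (2 * k) · negPoch₋₁ (2 * k)) ⊕ 0#
        ≈⟨ +-cong (Σ<-cong (suc n) (λ _ _ → *-identityʳ _)) (Σ<-zero n (λ _ _ → zeroʳ _)) ⟨
      Σ< (suc n) (λ k → qbin (2 * n) (2 * k) · negPoch₋₁ (2 * k) · 1#) ⊕
      Σ< n (λ k → qbin (2 * n) (suc (2 * k)) · 0# · 0#)
        ≈⟨ ⋆-interleave-even _ _ _ _ n ⟨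
      (evenPart negPoch₋₁ ⋆ cosh) (2 * n) ∎
    odd : ∀ n → (oddPart negPoch₋₁ ⋆ sinh) (suc (2 * n)) ≈ (evenPart negPoch₋₁ ⋆ cosh) (suc (2 * n))
    odd n = begin
      (oddPart negPoch₋₁ ⋆ sinh) (suc (2 * n))
        ≈⟨ ⋆-interleave-odd _ _ _ _ n ⟩
      Σ< (suc n) (λ k → qbin (suc (2 * n)) (2 * k) · 0# · 1# ⊕
                        qbin (suc (2 * n)) (suc (2 * k)) · negPoch (2 * k) · 0#)
        ≈⟨ Σ<-zero (suc n) (λ _ _ → trans (+-cong (x·0·y≈0 _ _) (zeroʳ _)) (+-identityʳ 0#)) ⟩
      0#
        ≈⟨ Σ<-zero (suc n) (λ _ _ → trans (+-cong (zeroʳ _) (x·0·y≈0 _ _)) (+-identityʳ 0#)) ⟨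
      Σ< (suc n) (λ k → qbin (suc (2 * n)) (2 * k) · negPoch₋₁ (2 * k) · 0# ⊕
                        qbin (suc (2 * n)) (suc (2 * k)) · 0# · 1#)
        ≈⟨ ⋆-interleave-odd _ _ _ _ n ⟨
      (evenPart negPoch₋₁ ⋆ cosh) (suc (2 * n)) ∎

  tanh⋆oddPart : tanh ⋆ oddPart negPoch₋₁ ≋ evenPart negPoch₋₁
  tanh⋆oddPart = ⋆-cancelʳ cosh refl λ N → begin
    (tanh ⋆ oddPart negPoch₋₁ ⋆ cosh) N    ≈⟨ ⋆-assoc tanh (oddPart negPoch₋₁) cosh N ⟩
    (tanh ⋆ (oddPart negPoch₋₁ ⋆ cosh)) N  ≈⟨ ⋆-congˡ tanh (⋆-comm (oddPart negPoch₋₁) cosh) N ⟩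
    (tanh ⋆ (cosh ⋆ oddPart negPoch₋₁)) N  ≈⟨ ⋆-assoc tanh cosh (oddPart negPoch₋₁) N ⟨
    (tanh ⋆ cosh ⋆ oddPart negPoch₋₁) N    ≈⟨ ⋆-congʳ (oddPart negPoch₋₁) tanh⋆cosh N ⟩
    (sinh ⋆ oddPart negPoch₋₁) N           ≈⟨ ⋆-comm sinh (oddPart negPoch₋₁) N ⟩
    (oddPart negPoch₋₁ ⋆ sinh) N           ≈⟨ oddPart⋆sinh N ⟩
    (evenPart negPoch₋₁ ⋆ cosh) N          ∎

  tangent-coefficient : ∀ m → Σ< (suc m) (λ k → qbin (2 * suc m) (suc (2 * k)) · negPoch (2 * (m ∸ k)) · sgn k · E k) ≈
                              negPoch (suc (2 * m))
  tangent-coefficient m = begin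
    Σ< (suc m) (λ k → qbin (2 * suc m) (suc (2 * k)) · negPoch (2 * (m ∸ k)) · sgn k · E k)
      ≈⟨ Σ<-cong (suc m) (λ k _ → solve 4 (λ b p s e → b :* p :* s :* e := b :* (s :* e) :* p)
           refl (qbin (2 * suc m) (suc (2 * k))) (negPoch (2 * (m ∸ k))) (sgn k) (E k)) ⟩
    Σ< (suc m) T
      ≈⟨ +-identityˡ _ ⟨
    0# ⊕ Σ< (suc m) T
      ≈⟨ +-congʳ (Σ<-zero (suc (suc m)) (λ _ _ → zeroʳ _)) ⟨
    Σ< (suc (suc m)) (λ k → qbin (2 * suc m) (2 * k) · 0# · 0#) ⊕ Σ< (suc m) T
      ≈⟨ ⋆-interleave-even _ _ _ _ (suc m) ⟨
    (tanh ⋆ oddPart negPoch₋₁) (2 * suc m)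
      ≈⟨ tanh⋆oddPart (2 * suc m) ⟩
    evenPart negPoch₋₁ (2 * suc m)
      ≡⟨ interleave-even (negPoch₋₁ ∘ (2 *_)) (const 0#) (suc m) ⟩
    negPoch₋₁ (2 * suc m)
      ≡⟨ ≡.cong negPoch₋₁ (ℕ.*-suc 2 m) ⟩
    negPoch (suc (2 * m)) ∎
    where
    T : ℕ → Carrier
    T k = qbin (2 * suc m) (suc (2 * k)) · (sgn k · E k) · negPoch (2 * (m ∸ k))

theorem2p1 : ∀ {c ℓ : Level} (R : CommutativeRing c ℓ) (q : CommutativeRing.Carrier R) (n : ℕ) → 1 ≤ n →
    let open CommutativeRing R using (_≈_) renaming (_*_ to _·_)
        open Q R q
    in Σ< n (λ k → qbin (2 * n) (2 * k + 1) · negPoch (2 * n ∸ (2 * k + 2)) · sgn k · E k)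
         ≈ negPoch (2 * n ∸ 1)
theorem2p1 R q (suc m) _ = begin
    Σ< (suc m) (λ k → qbin (2 * suc m) (2 * k + 1) · negPoch (2 * suc m ∸ (2 * k + 2)) · sgn k · E k)
      ≈⟨ Σ<-cong (suc m) (λ k _ → reflexive (reindex k)) ⟩
    Σ< (suc m) (λ k → qbin (2 * suc m) (suc (2 * k)) · negPoch (2 * (m ∸ k)) · sgn k · E k)
      ≈⟨ tangent-coefficient m ⟩
    negPoch (suc (2 * m))
      ≡⟨ ≡.cong (λ i → negPoch (i ∸ 1)) (ℕ.*-suc 2 m) ⟨
    negPoch (2 * suc m ∸ 1) ∎
  where
  open CommutativeRing R using (setoid; reflexive) renaming (_*_ to _·_)
  open Q R q
  open QSeries R q
  open SetoidReasoning setoid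
  reindex : ∀ k → qbin (2 * suc m) (2 * k + 1) · negPoch (2 * suc m ∸ (2 * k + 2)) · sgn k · E k
                ≡ qbin (2 * suc m) (suc (2 * k)) · negPoch (2 * (m ∸ k)) · sgn k · E k
  reindex k = ≡.cong₂ (λ i j → qbin (2 * suc m) i · negPoch j · sgn k · E k)
    (ℕ.+-comm (2 * k) 1)
    (≡.trans (≡.cong (2 * suc m ∸_) (≡.trans (ℕ.+-comm (2 * k) 2) (≡.sym (ℕ.*-suc 2 k))))
             (≡.sym (ℕ.*-distribˡ-∸ 2 (suc m) (suc k))))
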